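{- Let $q$ be a power of $2$ and let $K$ be an affinely complete $k$-arc in $PG(2,q)$ such that the point $(0,0,1)$ lies on a line joining two distinct points of $K$. Assume $k<q-5$. Then there exist $m_1,m_2\in\mathbb{F}_q^*$ with $m_1\ne m_2$, $(m_1+m_2)^3\ne1$, $m_1\neq 1$, $m_2\ne1$, such that $1\notin S_{m_1}(K)\cup S_{m_2}(K)$.
   Context: In $PG(2,q)$ with coordinates $(X_0,X_1,X_2)$, $l_\infty$ is the line $X_0=0$. An arc is a set of points no three collinear. An affine arc is an arc disjoint from $l_\infty$; it is affinely complete if every point of $PG(2,q)\setminus l_\infty$ lies on a line joining two distinct points of the arc. Points of $K$ are written in normalized form (first nonzero coordinate $1$). For $m\in\mathbb{F}_q$, $S_m(K)=\{X_1+Y_1:(X_0,X_1,X_2),(Y_0,Y_1,Y_2)\in K, X_0=Y_0, X_1\ne Y_1, \frac{X_2+Y_2}{X_1+Y_1}=m\}$. -}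

module Defs where

open import Level using (0ℓ)
open import Data.Nat using (ℕ; _^_; _≤_; _<_; _∸_)
open import Data.Product using (_×_; _,_; Σ; ∃; ∃-syntax; proj₁; proj₂)
open import Data.List using (List; length)
open import Data.List.Membership.Propositional using (_∈_)
open import Data.List.Relation.Unary.All using (All)
open import Data.List.Relation.Unary.Unique.Propositional using (Unique)
open import Relation.Binary.PropositionalEquality using (_≡_; _≢_)
open import Relation.Nullary using (¬_)
open import Relation.Binary.Definitions using (DecidableEquality)
open import Algebra.Structures using (IsCommutativeRing)

record FiniteField : Set₁ where
  infixl 6 _+_
  infixl 7 _*_
  field
    Carrier : Set
    _+_ _*_ : Carrier → Carrier → Carrier
    -_      : Carrier → Carrier
    0# 1#   : Carrier
    isCommutativeRing : IsCommutativeRing _≡_ _+_ _*_ -_ 0# 1#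
    _⁻¹     : Carrier → Carrier
    ⁻¹-inverse : ∀ x → x ≢ 0# → x * (x ⁻¹) ≡ 1#
    0≢1     : 0# ≢ 1#
    _≟_     : DecidableEquality Carrier
    elements : List Carrier
    complete : ∀ x → x ∈ elements
    distinct : Unique elements

  order : ℕ
  order = length elements

  _/_ : Carrier → Carrier → Carrier
  x / y = x * (y ⁻¹)

module Plane (F : FiniteField) where
  open FiniteField F

  Triple : Set
  Triple = Carrier × Carrier × Carrier

  X₀ X₁ X₂ : Triple → Carrier
  X₀ (a , _ , _) = a
  X₁ (_ , b , _) = b
  X₂ (_ , _ , c) = c

  Normalized : Triple → Set
  Normalized (a , b , c) =
    (a ≡ 1#) ⊎' ((a ≡ 0# × b ≡ 1#) ⊎' (a ≡ 0# × b ≡ 0# × c ≡ 1#))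
    where
    open import Data.Sum using () renaming (_⊎_ to _⊎'_)

  det : Triple → Triple → Triple → Carrier
  det (a₀ , a₁ , a₂) (b₀ , b₁ , b₂) (c₀ , c₁ , c₂) =
      a₀ * (b₁ * c₂ + - (b₂ * c₁))
    + - (a₁ * (b₀ * c₂ + - (b₂ * c₀)))
    + a₂ * (b₀ * c₁ + - (b₁ * c₀))

  Collinear : Triple → Triple → Triple → Set
  Collinear P Q R = det P Q R ≡ 0#

  PointSet : List Triple → Set
  PointSet K = All Normalized K × Unique K

  IsArc : List Triple → Set
  IsArc K = PointSet K ×
    (∀ P Q R → P ∈ K → Q ∈ K → R ∈ K →
       P ≢ Q → P ≢ R → Q ≢ R → ¬ Collinear P Q R)

  OnSecant : List Triple → Triple → Set
  OnSecant K R = ∃[ P ] ∃[ Q ] (P ∈ K × Q ∈ K × P ≢ Q × Collinear P Q R)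

  IsAffineArc : List Triple → Set
  IsAffineArc K = IsArc K × All (λ P → X₀ P ≢ 0#) K

  IsAffinelyComplete : List Triple → Set
  IsAffinelyComplete K =
    IsAffineArc K × (∀ a b → OnSecant K (1# , a , b))

  InS : Carrier → List Triple → Carrier → Set
  InS m K s = ∃[ X ] ∃[ Y ] (X ∈ K × Y ∈ K × X₀ X ≡ X₀ Y × X₁ X ≢ X₁ Y ×
               ((X₂ X + X₂ Y) / (X₁ X + X₁ Y) ≡ m) × s ≡ X₁ X + X₁ Y)

module Submission where

-- Let K be an affine k-arc in PG(2,q), q = 2^h, with k < q - 5.  Points of K
-- are (1, x, y), and 1 ∈ S_m(K) only when m = y_P + y_Q for two points
-- P, Q of K on "consecutive" vertical lines X₁ = c and X₁ = c + 1.
--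
-- 1. Consecutiveness is a symmetric irreflexive relation on K (char 2) of
--    maximum degree 2 (a vertical line meets the arc at most twice).  The
--    handshake lemma, sum over edges of w P + w Q = sum over vertices of
--    deg P · w P, shows that the list of slopes y_P + y_Q over the edges has
--    length at most k, and, when its length is exactly k, every degree is 2
--    and the slopes sum to 0.
-- 2. Excluding 0, 1 and the slopes leaves at least four field elements.
--    Take an admissible m₁, then an admissible g ∉ {m₁, m₁ + 1}.  If
--    (m₁ + g)³ ≠ 1 we are done.  Otherwise ω = m₁ + g satisfies
--    ω² + ω + 1 = 0, and any admissible m₂ outside the coset m₁ + {0,1,ω,ω+1}
--    works.  If there were none, the field would be exactly the disjoint union
--    of {0, 1}, k slopes and that coset; summing all field elements then gives
--    0 = 0 + 1 + 0 + 0, a contradiction.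

open import Defs
open import Level using (0ℓ)
open import Data.Nat using (ℕ; zero; suc; _^_; _≤_; _<_; _∸_; z≤n; s≤s; s≤s⁻¹) renaming (_+_ to _+ℕ_)
import Data.Nat.Properties as ℕ
open import Data.Bool using (Bool; true; false; _xor_; _∧_)
open import Data.Maybe using (Maybe; just; nothing)
open import Data.Product using (_×_; _,_; ∃-syntax; proj₁; proj₂)
open import Data.Sum using (_⊎_; inj₁; inj₂)
import Data.Sum as Sum
open import Data.List using (List; []; _∷_; _++_; length; map; filter)
open import Data.List.Properties using (length-map)
open import Data.List.Membership.Propositional using (_∈_; _∉_)
open import Data.List.Membership.Propositional.Properties
  using (∈-∃++; ∈-map⁺; ∈-filter⁺; ∈-filter⁻; ∈-++⁺ˡ; ∈-++⁺ʳ)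
open import Data.List.Relation.Unary.Any using (here; there; satisfied)
open import Data.List.Relation.Unary.All using (All; all?; _∷_)
import Data.List.Relation.Unary.All as All
open import Data.List.Relation.Unary.All.Properties using (¬All⇒Any¬)
open import Data.List.Relation.Unary.AllPairs using (_∷_)
open import Data.List.Relation.Unary.Unique.Propositional using (Unique)
import Data.List.Relation.Unary.Unique.Propositional.Properties as Unique
open import Data.List.Relation.Binary.Subset.Propositional using (_⊆_)
open import Data.List.Relation.Binary.Permutation.Propositional
  using (_↭_; refl; prep; swap; trans; ↭-refl; ↭-prep; ↭-trans; ↭-sym)
open import Data.List.Relation.Binary.Permutation.Propositional.Properties
  using (∈-resp-↭; ↭-length; shift)
open import Relation.Binary.PropositionalEquality
  using (_≡_; _≢_; refl; sym; cong; cong₂; subst; module ≡-Reasoning)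
  renaming (trans to ≡-trans)
open import Relation.Nullary using (¬_; Dec; yes; no; contradiction)
open import Algebra.Bundles using (Monoid; CommutativeSemigroup; CommutativeRing; RawRing)
open import Algebra.Structures using (IsCommutativeMonoid; IsCommutativeRing)
open import Algebra.Solver.Ring.AlmostCommutativeRing
  using (fromCommutativeRing; _-Raw-AlmostCommutative⟶_)
open import Function using (id; _∘_)

module DistinctLists {A : Set} where

  private
    extract : ∀ {x : A} {ys} → x ∈ ys → ∃[ ys′ ] ys ↭ x ∷ ys′
    extract {x} x∈ys with ys₁ , ys₂ , refl ← ∈-∃++ x∈ys = ys₁ ++ ys₂ , shift x ys₁ ys₂

    ⊆-extract : ∀ {x : A} {xs ys ys′} → All (x ≢_) xs → x ∷ xs ⊆ ys → ys ↭ x ∷ ys′ → xs ⊆ ys′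
    ⊆-extract x∉xs sub ys↭ z∈xs with ∈-resp-↭ ys↭ (sub (there z∈xs))
    ... | here refl = contradiction refl (All.lookup x∉xs z∈xs)
    ... | there z∈ys′ = z∈ys′

  unique-⊆⇒length-≤ : ∀ {xs ys : List A} → Unique xs → xs ⊆ ys → length xs ≤ length ys
  unique-⊆⇒length-≤ {[]} _ _ = z≤n
  unique-⊆⇒length-≤ {x ∷ xs} (x∉xs ∷ uxs) sub
    with ys′ , ys↭ ← extract (sub (here refl))
    = subst (suc (length xs) ≤_) (sym (↭-length ys↭))
            (s≤s (unique-⊆⇒length-≤ uxs (⊆-extract x∉xs sub ys↭)))

  unique-⊆-length⇒↭ : ∀ {xs ys : List A} → Unique xs → xs ⊆ ys → length ys ≤ length xs → xs ↭ ys
  unique-⊆-length⇒↭ {[]} {[]} _ _ _ = ↭-refl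
  unique-⊆-length⇒↭ {x ∷ xs} (x∉xs ∷ uxs) sub ys≤
    with ys′ , ys↭ ← extract (sub (here refl))
    = ↭-trans (↭-prep x (unique-⊆-length⇒↭ uxs (⊆-extract x∉xs sub ys↭) ys′≤))
              (↭-sym ys↭)
    where
    ys′≤ : length ys′ ≤ length xs
    ys′≤ = s≤s⁻¹ (subst (_≤ suc (length xs)) (↭-length ys↭) ys≤)

open DistinctLists

module ListSum {M : Set} {_∙_ : M → M → M} {ε : M} (isCM : IsCommutativeMonoid _≡_ _∙_ ε) where

  open IsCommutativeMonoid isCM using (assoc; identityˡ; isMonoid; isCommutativeSemigroup)
  private
    commutativeSemigroup : CommutativeSemigroup 0ℓ 0ℓ
    commutativeSemigroup = record { isCommutativeSemigroup = isCommutativeSemigroup }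

    monoid : Monoid 0ℓ 0ℓ
    monoid = record { isMonoid = isMonoid }

  open import Algebra.Properties.CommutativeSemigroup commutativeSemigroup
    using (interchange; x∙yz≈y∙xz)
  open import Algebra.Properties.Monoid.Mult monoid public
    using () renaming (_×_ to _·_)

  ∑ : {B : Set} → (B → M) → List B → M
  ∑ f [] = ε
  ∑ f (x ∷ xs) = f x ∙ ∑ f xs

  when : {P : Set} → Dec P → M → M
  when (yes _) v = v
  when (no _) _ = ε

  module _ {B : Set} where

    ∑-cong : ∀ {f g : B → M} xs → (∀ {x} → x ∈ xs → f x ≡ g x) → ∑ f xs ≡ ∑ g xs
    ∑-cong [] _ = refl
    ∑-cong (x ∷ xs) f≡g = cong₂ _∙_ (f≡g (here refl)) (∑-cong xs (f≡g ∘ there))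

    ∑-++ : ∀ (f : B → M) xs ys → ∑ f (xs ++ ys) ≡ ∑ f xs ∙ ∑ f ys
    ∑-++ f [] ys = sym (identityˡ _)
    ∑-++ f (x ∷ xs) ys = ≡-trans (cong (f x ∙_) (∑-++ f xs ys)) (sym (assoc _ _ _))

    ∑-map : ∀ {C : Set} (g : C → M) (f : B → C) xs → ∑ g (map f xs) ≡ ∑ (g ∘ f) xs
    ∑-map g f [] = refl
    ∑-map g f (x ∷ xs) = cong (g (f x) ∙_) (∑-map g f xs)

    ∑-↭ : ∀ (f : B → M) {xs ys} → xs ↭ ys → ∑ f xs ≡ ∑ f ys
    ∑-↭ f refl = refl
    ∑-↭ f (prep x p) = cong (f x ∙_) (∑-↭ f p)
    ∑-↭ f (swap x y p) = ≡-trans (x∙yz≈y∙xz (f x) (f y) _) (cong (λ t → f y ∙ (f x ∙ t)) (∑-↭ f p))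
    ∑-↭ f (trans p q) = ≡-trans (∑-↭ f p) (∑-↭ f q)

    ∑-∙ : ∀ (f g : B → M) xs → ∑ (λ x → f x ∙ g x) xs ≡ ∑ f xs ∙ ∑ g xs
    ∑-∙ f g [] = sym (identityˡ ε)
    ∑-∙ f g (x ∷ xs) = ≡-trans (cong ((f x ∙ g x) ∙_) (∑-∙ f g xs)) (interchange _ _ _ _)

    ∑-const : ∀ (xs : List B) v → ∑ (λ _ → v) xs ≡ length xs · v
    ∑-const [] v = refl
    ∑-const (x ∷ xs) v = cong (v ∙_) (∑-const xs v)

    ∑-ε : ∀ (xs : List B) → ∑ (λ _ → ε) xs ≡ ε
    ∑-ε [] = refl
    ∑-ε (x ∷ xs) = ≡-trans (identityˡ _) (∑-ε xs)

    ∑-filter : ∀ {P : B → Set} (P? : ∀ x → Dec (P x)) (f : B → M) xs →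
               ∑ f (filter P? xs) ≡ ∑ (λ x → when (P? x) (f x)) xs
    ∑-filter P? f [] = refl
    ∑-filter P? f (x ∷ xs) with P? x
    ... | yes _ = cong (f x ∙_) (∑-filter P? f xs)
    ... | no _ = ≡-trans (∑-filter P? f xs) (sym (identityˡ _))

module ℕSum where

  open import Data.Nat using (_+_; _*_)

  open ListSum ℕ.+-0-isCommutativeMonoid public

  ·≡* : ∀ n m → n · m ≡ n * m
  ·≡* zero m = refl
  ·≡* (suc n) m = cong (m +_) (·≡* n m)

  module _ {B : Set} where

    ∑-mono-≤ : ∀ {f g : B → ℕ} xs → (∀ {x} → x ∈ xs → f x ≤ g x) → ∑ f xs ≤ ∑ g xs
    ∑-mono-≤ [] _ = z≤n
    ∑-mono-≤ (x ∷ xs) f≤g = ℕ.+-mono-≤ (f≤g (here refl)) (∑-mono-≤ xs (f≤g ∘ there))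

    private
      tight-∷ : ∀ {f g : B → ℕ} x xs → (∀ {y} → y ∈ x ∷ xs → f y ≤ g y) →
                ∑ g (x ∷ xs) ≤ ∑ f (x ∷ xs) → f x ≡ g x × ∑ g xs ≤ ∑ f xs
      tight-∷ {f} {g} x xs f≤g sum≤ =
          ℕ.≤-antisym fx≤gx (ℕ.+-cancelʳ-≤ (∑ g xs) (g x) (f x) (ℕ.≤-trans sum≤ (ℕ.+-monoʳ-≤ (f x) tail≤)))
        , ℕ.+-cancelˡ-≤ (g x) (∑ g xs) (∑ f xs) (ℕ.≤-trans sum≤ (ℕ.+-monoˡ-≤ (∑ f xs) fx≤gx))
        where
        fx≤gx : f x ≤ g x
        fx≤gx = f≤g (here refl)
        tail≤ : ∑ f xs ≤ ∑ g xs
        tail≤ = ∑-mono-≤ xs (f≤g ∘ there)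

    ∑-tight : ∀ {f g : B → ℕ} xs → (∀ {x} → x ∈ xs → f x ≤ g x) →
              ∑ g xs ≤ ∑ f xs → ∀ {x} → x ∈ xs → f x ≡ g x
    ∑-tight (x ∷ xs) f≤g sum≤ (here refl) = proj₁ (tight-∷ x xs f≤g sum≤)
    ∑-tight (x ∷ xs) f≤g sum≤ (there y∈xs) = ∑-tight xs (f≤g ∘ there) (proj₂ (tight-∷ x xs f≤g sum≤)) y∈xs

-- Each edge {a, b} is
-- listed once, as (a , b) with a occurring before b.
module Handshake {A : Set} {R : A → A → Set} (R? : ∀ a b → Dec (R a b))
                 (R-sym : ∀ {a b} → R a b → R b a) (R-irrefl : ∀ {a} → ¬ R a a) where

  neighbours : List A → A → List A
  neighbours xs a = filter (R? a) xs

  degree : List A → A → ℕ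
  degree xs a = length (neighbours xs a)

  edges : List A → List (A × A)
  edges [] = []
  edges (a ∷ as) = map (a ,_) (neighbours as a) ++ edges as

  edge-∈ : ∀ {a b xs} → a ∈ xs → b ∈ xs → a ≢ b → R a b →
           (a , b) ∈ edges xs ⊎ (b , a) ∈ edges xs
  edge-∈ (here refl) (here refl) a≢b _ = contradiction refl a≢b
  edge-∈ (here refl) (there b∈) _ r = inj₁ (∈-++⁺ˡ (∈-map⁺ (_ ,_) (∈-filter⁺ (R? _) b∈ r)))
  edge-∈ (there a∈) (here refl) _ r = inj₂ (∈-++⁺ˡ (∈-map⁺ (_ ,_) (∈-filter⁺ (R? _) a∈ (R-sym r))))
  edge-∈ (there a∈) (there b∈) a≢b r =
    Sum.map (∈-++⁺ʳ _) (∈-++⁺ʳ _) (edge-∈ a∈ b∈ a≢b r)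

  module _ {M : Set} {_∙_ : M → M → M} {ε : M} (isCM : IsCommutativeMonoid _≡_ _∙_ ε) where

    open ListSum isCM
    open IsCommutativeMonoid isCM using (assoc; identityˡ)
    open ≡-Reasoning

    private
      degree-self : ∀ a as → degree (a ∷ as) a ≡ degree as a
      degree-self a as with R? a a
      ... | yes r = contradiction r R-irrefl
      ... | no _ = refl

      degree-cons : ∀ a as b v → degree (a ∷ as) b · v ≡ when (R? b a) v ∙ (degree as b · v)
      degree-cons a as b v with R? b a
      ... | yes _ = refl
      ... | no _ = sym (identityˡ _)

      when-sym : ∀ a b v → when (R? a b) v ≡ when (R? b a) v
      when-sym a b v with R? a b | R? b a
      ... | yes _ | yes _ = refl
      ... | no _  | no _  = refl
      ... | yes r | no ¬r = contradiction (R-sym r) ¬r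
      ... | no ¬r | yes r = contradiction (R-sym r) ¬r

    handshake : (w : A → M) (xs : List A) →
                ∑ (λ e → w (proj₁ e) ∙ w (proj₂ e)) (edges xs) ≡ ∑ (λ a → degree xs a · w a) xs
    handshake w [] = refl
    handshake w (a ∷ as) = begin
      ∑ wₑ (map (a ,_) nbrs ++ edges as)         ≡⟨ ∑-++ wₑ (map (a ,_) nbrs) (edges as) ⟩
      ∑ wₑ (map (a ,_) nbrs) ∙ ∑ wₑ (edges as)   ≡⟨ cong₂ _∙_ (∑-map wₑ (a ,_) nbrs) (handshake w as) ⟩
      ∑ (λ b → w a ∙ w b) nbrs ∙ rest            ≡⟨ cong (_∙ rest) (∑-∙ (λ _ → w a) w nbrs) ⟩
      (∑ (λ _ → w a) nbrs ∙ ∑ w nbrs) ∙ rest     ≡⟨ cong (λ t → (t ∙ ∑ w nbrs) ∙ rest) (∑-const nbrs (w a)) ⟩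
      ((degree as a · w a) ∙ ∑ w nbrs) ∙ rest    ≡⟨ assoc _ _ _ ⟩
      (degree as a · w a) ∙ (∑ w nbrs ∙ rest)
        ≡⟨ cong₂ _∙_ (cong (_· w a) (sym (degree-self a as))) new-neighbour ⟩
      (degree (a ∷ as) a · w a) ∙ ∑ (λ b → degree (a ∷ as) b · w b) as ∎
      where
      wₑ : A × A → M
      wₑ e = w (proj₁ e) ∙ w (proj₂ e)
      nbrs : List A
      nbrs = neighbours as a
      rest : M
      rest = ∑ (λ b → degree as b · w b) as
      -- the weights of a's neighbours are exactly what a adds to their degrees
      new-neighbour : ∑ w nbrs ∙ rest ≡ ∑ (λ b → degree (a ∷ as) b · w b) as
      new-neighbour = begin
        ∑ w nbrs ∙ rest                                    ≡⟨ cong (_∙ rest) (∑-filter (R? a) w as) ⟩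
        ∑ (λ b → when (R? a b) (w b)) as ∙ rest            ≡⟨ sym (∑-∙ _ _ as) ⟩
        ∑ (λ b → when (R? a b) (w b) ∙ (degree as b · w b)) as
          ≡⟨ ∑-cong as (λ {b} _ → ≡-trans (cong (_∙ _) (when-sym a b (w b))) (sym (degree-cons a as b (w b)))) ⟩
        ∑ (λ b → degree (a ∷ as) b · w b) as               ∎

  module _ {xs : List A} (degree≤2 : ∀ {a} → a ∈ xs → degree xs a ≤ 2) where

    open ℕSum
    open import Data.Nat using (_*_)

    private
      twice-edges : length (edges xs) * 2 ≡ ∑ (degree xs) xs
      twice-edges = begin
        length (edges xs) * 2                           ≡⟨ sym (·≡* (length (edges xs)) 2) ⟩
        length (edges xs) · 2                           ≡⟨ sym (∑-const (edges xs) 2) ⟩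
        ∑ (λ _ → 2) (edges xs)                          ≡⟨ handshake ℕ.+-0-isCommutativeMonoid (λ _ → 1) xs ⟩
        ∑ (λ a → degree xs a · 1) xs                    ≡⟨ ∑-cong xs (λ {a} _ → ≡-trans (·≡* (degree xs a) 1) (ℕ.*-identityʳ (degree xs a))) ⟩
        ∑ (degree xs) xs                                ∎
        where open ≡-Reasoning

      twice-vertices : ∑ (λ _ → 2) xs ≡ length xs * 2
      twice-vertices = ≡-trans (∑-const xs 2) (·≡* (length xs) 2)

    edges-≤ : length (edges xs) ≤ length xs
    edges-≤ = ℕ.*-cancelʳ-≤ (length (edges xs)) (length xs) 2 (begin
      length (edges xs) * 2   ≡⟨ twice-edges ⟩
      ∑ (degree xs) xs        ≤⟨ ∑-mono-≤ xs degree≤2 ⟩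
      ∑ (λ _ → 2) xs          ≡⟨ twice-vertices ⟩
      length xs * 2           ∎)
      where open ℕ.≤-Reasoning

    degree≡2 : length xs ≤ length (edges xs) → ∀ {a} → a ∈ xs → degree xs a ≡ 2
    degree≡2 many = ∑-tight xs degree≤2 (begin
      ∑ (λ _ → 2) xs          ≡⟨ twice-vertices ⟩
      length xs * 2           ≤⟨ ℕ.*-monoˡ-≤ 2 many ⟩
      length (edges xs) * 2   ≡⟨ twice-edges ⟩
      ∑ (degree xs) xs        ∎)
      where open ℕ.≤-Reasoning

module FieldFacts (F : FiniteField) where

  open FiniteField F
  open IsCommutativeRing isCommutativeRing
    using (+-isCommutativeMonoid; +-identityʳ; *-comm; *-assoc; *-identityˡ; *-identityʳ; zeroʳ; distribʳ; distribˡ)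
  open ListSum +-isCommutativeMonoid public
  open import Data.List.Membership.DecPropositional _≟_ using (_∈?_)
  open ≡-Reasoning

  ring : CommutativeRing 0ℓ 0ℓ
  ring = record { isCommutativeRing = isCommutativeRing }

  open import Algebra.Properties.Monoid.Mult (CommutativeRing.+-monoid ring) using (×-assocˡ)

  open import Algebra.Properties.Group (CommutativeRing.+-group ring) public
    using (ε⁻¹≈ε; inverseˡ-unique) renaming (∙-cancelˡ to +-cancelˡ; ∙-cancelʳ to +-cancelʳ)

  ⁻¹-cancel : ∀ {a} b → a ≢ 0# → a ⁻¹ * (a * b) ≡ b
  ⁻¹-cancel {a} b a≢0 = begin
    a ⁻¹ * (a * b)   ≡⟨ sym (*-assoc _ _ _) ⟩
    a ⁻¹ * a * b     ≡⟨ cong (_* b) (≡-trans (*-comm _ _) (⁻¹-inverse a a≢0)) ⟩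
    1# * b           ≡⟨ *-identityˡ b ⟩
    b                ∎

  nonzero-cancel : ∀ {a b} → a ≢ 0# → a * b ≡ 0# → b ≡ 0#
  nonzero-cancel {a} {b} a≢0 ab≡0 =
    ≡-trans (sym (⁻¹-cancel b a≢0)) (≡-trans (cong (a ⁻¹ *_) ab≡0) (zeroʳ _))

  *-cancelˡ-nonzero : ∀ {a b c} → a ≢ 0# → a * b ≡ a * c → b ≡ c
  *-cancelˡ-nonzero {a} {b} {c} a≢0 ab≡ac =
    ≡-trans (sym (⁻¹-cancel b a≢0)) (≡-trans (cong (a ⁻¹ *_) ab≡ac) (⁻¹-cancel c a≢0))

  /1 : ∀ a → a / 1# ≡ a
  /1 a = begin
    a * 1# ⁻¹        ≡⟨ cong (a *_) (≡-trans (sym (*-identityˡ _)) (⁻¹-inverse 1# (0≢1 ∘ sym))) ⟩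
    a * 1#           ≡⟨ *-identityʳ a ⟩
    a                ∎

  ∑-scale : ∀ c xs → ∑ (c *_) xs ≡ c * ∑ id xs
  ∑-scale c [] = sym (zeroʳ c)
  ∑-scale c (x ∷ xs) = ≡-trans (cong (c * x +_) (∑-scale c xs)) (sym (distribˡ c x _))

  escape-or-cover : (xs : List Carrier) → (∃[ x ] x ∉ xs) ⊎ (∀ x → x ∈ xs)
  escape-or-cover xs with all? (_∈? xs) elements
  ... | yes all∈ = inj₂ (λ x → All.lookup all∈ (complete x))
  ... | no ¬all∈ = inj₁ (satisfied (¬All⇒Any¬ (_∈? xs) elements ¬all∈))

  escape : (xs : List Carrier) → length xs < order → ∃[ x ] x ∉ xs
  escape xs short with escape-or-cover xs
  ... | inj₁ found = found
  ... | inj₂ cover = contradiction (unique-⊆⇒length-≤ distinct (λ {x} _ → cover x)) (ℕ.<⇒≱ short)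

  cover⇒↭ : ∀ {xs} → (∀ x → x ∈ xs) → length xs ≤ order → elements ↭ xs
  cover⇒↭ cover short = unique-⊆-length⇒↭ distinct (λ {x} _ → cover x) short

  -- An injective map permutes the field, so it preserves the sum of all elements.
  ∑-injective : ∀ f → (∀ {a b} → f a ≡ f b → a ≡ b) → ∑ f elements ≡ ∑ id elements
  ∑-injective f f-inj = begin
    ∑ f elements              ≡⟨ sym (∑-map id f elements) ⟩
    ∑ id (map f elements)     ≡⟨ ∑-↭ id (unique-⊆-length⇒↭ (Unique.map⁺ f-inj distinct) (λ {x} _ → complete x) image-long) ⟩
    ∑ id elements             ∎
    where
    image-long : length elements ≤ length (map f elements)
    image-long = ℕ.≤-reflexive (sym (length-map f elements))

  -- Translation by 1 permutes F, so q · 1 = 0.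
  order·1≡0 : order · 1# ≡ 0#
  order·1≡0 = +-cancelˡ (∑ id elements) _ _ (begin
    ∑ id elements + order · 1#              ≡⟨ cong (∑ id elements +_) (sym (∑-const elements 1#)) ⟩
    ∑ id elements + ∑ (λ _ → 1#) elements   ≡⟨ sym (∑-∙ id (λ _ → 1#) elements) ⟩
    ∑ (_+ 1#) elements                      ≡⟨ ∑-injective (_+ 1#) (λ {a} {b} → +-cancelʳ 1# a b) ⟩
    ∑ id elements                           ≡⟨ sym (+-identityʳ _) ⟩
    ∑ id elements + 0#                      ∎)

  -- If 1 + 1 ≠ 0 then 2^h · 1 = (1 + 1)^h ≠ 0.
  2^h·1≢0 : 1# + 1# ≢ 0# → ∀ h → (2 ^ h) · 1# ≢ 0#
  2^h·1≢0 two≢0 zero one≡0 = 0≢1 (sym (≡-trans (sym (+-identityʳ 1#)) one≡0))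
  2^h·1≢0 two≢0 (suc h) doubled≡0 = 2^h·1≢0 two≢0 h (nonzero-cancel two≢0 (begin
    (1# + 1#) * (n · 1#)            ≡⟨ distribʳ _ 1# 1# ⟩
    1# * (n · 1#) + 1# * (n · 1#)   ≡⟨ cong₂ _+_ (*-identityˡ _) (*-identityˡ _) ⟩
    n · 1# + n · 1#                 ≡⟨ cong (n · 1# +_) (sym (+-identityʳ _)) ⟩
    2 · (n · 1#)                    ≡⟨ ×-assocˡ 1# 2 n ⟩
    (2 ^ suc h) · 1#                ≡⟨ doubled≡0 ⟩
    0#                              ∎))
    where n = 2 ^ h

  char2 : ∀ h → order ≡ 2 ^ h → 1# + 1# ≡ 0#
  char2 h q≡2^h with (1# + 1#) ≟ 0#
  ... | yes two≡0 = two≡0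
  ... | no two≢0 = contradiction (subst (λ n → n · 1# ≡ 0#) q≡2^h order·1≡0) (2^h·1≢0 two≢0 h)

-- Polynomial identities over 𝔽₂ hold in every field of characteristic 2; they
-- are proved by the ring solver with Boolean coefficients.
BoolRing : RawRing 0ℓ 0ℓ
BoolRing = record
  { Carrier = Bool ; _≈_ = _≡_ ; _+_ = _xor_ ; _*_ = _∧_ ; -_ = id ; 0# = false ; 1# = true }

module Char2 (F : FiniteField) (two≡0 : FiniteField._+_ F (FiniteField.1# F) (FiniteField.1# F) ≡ FiniteField.0# F) where

  open FiniteField F
  open IsCommutativeRing isCommutativeRing using (+-identityˡ; +-identityʳ; *-identityˡ; zeroˡ; distribʳ)
  open FieldFacts F
  open ≡-Reasoning

  private
    ⟦_⟧ : Bool → Carrier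
    ⟦ true ⟧ = 1#
    ⟦ false ⟧ = 0#

    𝔽₂-hom : BoolRing -Raw-AlmostCommutative⟶ fromCommutativeRing ring
    𝔽₂-hom = record
      { ⟦_⟧ = ⟦_⟧ ; +-homo = +-homo ; *-homo = *-homo ; -‿homo = -‿homo ; 0-homo = refl ; 1-homo = refl }
      where
      +-homo : ∀ a b → ⟦ a xor b ⟧ ≡ ⟦ a ⟧ + ⟦ b ⟧
      +-homo true true = sym two≡0
      +-homo true false = sym (+-identityʳ _)
      +-homo false b = sym (+-identityˡ _)
      *-homo : ∀ a b → ⟦ a ∧ b ⟧ ≡ ⟦ a ⟧ * ⟦ b ⟧
      *-homo true b = sym (*-identityˡ _)
      *-homo false b = sym (zeroˡ _)
      -‿homo : ∀ a → ⟦ a ⟧ ≡ - ⟦ a ⟧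
      -‿homo true = inverseˡ-unique 1# 1# two≡0
      -‿homo false = sym ε⁻¹≈ε

    -- equality of Boolean constants is decidable (only positive answers are used)
    coefficient-equal? : ∀ a b → Maybe (⟦ a ⟧ ≡ ⟦ b ⟧)
    coefficient-equal? true true = just refl
    coefficient-equal? false false = just refl
    coefficient-equal? _ _ = nothing

  open import Algebra.Solver.Ring BoolRing (fromCommutativeRing ring) 𝔽₂-hom coefficient-equal?
    using (solve; _:+_; _:*_; :-_; con; _:=_)

  x+x≡0 : ∀ x → x + x ≡ 0#
  x+x≡0 = solve 1 (λ x → x :+ x := con false) refl

  x+[x+y]≡y : ∀ x y → x + (x + y) ≡ y
  x+[x+y]≡y = solve 2 (λ x y → x :+ (x :+ y) := y) refl

  [x+y]+y≡x : ∀ x y → (x + y) + y ≡ x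
  [x+y]+y≡x = solve 2 (λ x y → (x :+ y) :+ y := x) refl

  sum≡0⇒≡ : ∀ {a b} → a + b ≡ 0# → a ≡ b
  sum≡0⇒≡ {a} {b} a+b≡0 = begin
    a             ≡⟨ sym (x+[x+y]≡y b a) ⟩
    b + (b + a)   ≡⟨ cong (b +_) (≡-trans (+-comm b a) a+b≡0) ⟩
    b + 0#        ≡⟨ +-identityʳ b ⟩
    b             ∎
    where open IsCommutativeRing isCommutativeRing using (+-comm)

  2·≡0 : ∀ v → 2 · v ≡ 0#
  2·≡0 v = ≡-trans (cong (v +_) (+-identityʳ v)) (x+x≡0 v)

  vertical-det : ∀ c p q r →
    1# * (c * r + - (q * c)) + - (c * (1# * r + - (q * 1#))) + p * (1# * c + - (c * 1#)) ≡ 0#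
  vertical-det = solve 4 (λ c p q r →
    con true :* (c :* r :+ :- (q :* c)) :+ :- (c :* (con true :* r :+ :- (q :* con true)))
    :+ p :* (con true :* c :+ :- (c :* con true)) := con false) refl

  cube : Carrier → Carrier
  cube z = z * z * z

  root-∉𝔽₂ : ∀ {ω} → ω * ω + ω + 1# ≡ 0# → ω ≢ 0# × ω ≢ 1#
  root-∉𝔽₂ {ω} ω-root =
      (λ ω≡0 → 0≢1 (≡-trans (sym ω-root) (≡-trans (cong quadratic ω≡0)
                      (solve 0 (con false :* con false :+ con false :+ con true := con true) refl))))
    , (λ ω≡1 → 0≢1 (≡-trans (sym ω-root) (≡-trans (cong quadratic ω≡1)
                      (solve 0 (con true :* con true :+ con true :+ con true := con true) refl))))
    where
    quadratic : Carrier → Carrier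
    quadratic z = z * z + z + 1#

  primitive-cube-root : ∀ {ω} → cube ω ≡ 1# → ω ≢ 1# → ω * ω + ω + 1# ≡ 0#
  primitive-cube-root {ω} ω³≡1 ω≢1 = nonzero-cancel (ω≢1 ∘ sum≡0⇒≡) (begin
    (ω + 1#) * (ω * ω + ω + 1#)   ≡⟨ solve 1 (λ ω → (ω :+ con true) :* (ω :* ω :+ ω :+ con true)
                                                     := ω :* ω :* ω :+ con true) refl ω ⟩
    cube ω + 1#                   ≡⟨ cong (_+ 1#) ω³≡1 ⟩
    1# + 1#                       ≡⟨ two≡0 ⟩
    0#                            ∎)

  cube-roots : ∀ {ω z} → ω * ω + ω + 1# ≡ 0# → cube z ≡ 1# → z ≡ 1# ⊎ z ≡ ω ⊎ z ≡ ω + 1#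
  cube-roots {ω} {z} ω-root z³≡1 with (z + 1#) ≟ 0# | (z + ω) ≟ 0#
  ... | yes z+1≡0 | _ = inj₁ (sum≡0⇒≡ z+1≡0)
  ... | no _ | yes z+ω≡0 = inj₂ (inj₁ (sum≡0⇒≡ z+ω≡0))
  ... | no z+1≢0 | no z+ω≢0 =
    inj₂ (inj₂ (sum≡0⇒≡ (nonzero-cancel z+ω≢0 (nonzero-cancel z+1≢0 factored))))
    where
    factored : (z + 1#) * ((z + ω) * (z + (ω + 1#))) ≡ 0#
    factored = begin
      (z + 1#) * ((z + ω) * (z + (ω + 1#)))
        ≡⟨ cong ((z + 1#) *_) (sym (≡-trans (cong (_ +_) ω-root) (+-identityʳ _))) ⟩
      (z + 1#) * ((z + ω) * (z + (ω + 1#)) + (ω * ω + ω + 1#))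
        ≡⟨ solve 2 (λ z ω → (z :+ con true) :* ((z :+ ω) :* (z :+ (ω :+ con true)) :+ (ω :* ω :+ ω :+ con true))
                           := z :* z :* z :+ con true) refl z ω ⟩
      cube z + 1#                                     ≡⟨ cong (_+ 1#) z³≡1 ⟩
      1# + 1#                                         ≡⟨ two≡0 ⟩
      0#                                              ∎

  -- The translate m + {0, 1, ω, ω + 1} of the subfield 𝔽₄ = {0, 1, ω, ω²}.
  coset : Carrier → Carrier → List Carrier
  coset m ω = m ∷ m + 1# ∷ m + ω ∷ m + (ω + 1#) ∷ []

  ∑-coset : ∀ m ω → ∑ id (coset m ω) ≡ 0#
  ∑-coset = solve 2 (λ m ω → m :+ ((m :+ con true) :+ ((m :+ ω) :+ ((m :+ (ω :+ con true)) :+ con false))) := con false) refl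

  translate : ∀ {m g t} → m + g ≡ t → g ≡ m + t
  translate {m} {g} m+g≡t = ≡-trans (sym (x+[x+y]≡y m g)) (cong (m +_) m+g≡t)

  cube-root-in-coset : ∀ {ω m g} → ω * ω + ω + 1# ≡ 0# → cube (m + g) ≡ 1# → g ∈ coset m ω
  cube-root-in-coset {ω} {m} {g} ω-root z³≡1 with cube-roots ω-root z³≡1
  ... | inj₁ z≡1 = there (here (translate z≡1))
  ... | inj₂ (inj₁ z≡ω) = there (there (here (translate z≡ω)))
  ... | inj₂ (inj₂ z≡ω+1) = there (there (there (here (translate z≡ω+1))))

  -- In a field with an element a ∉ {0, 1} the elements sum to 0: multiplication
  -- by a permutes F, so a · Σ = Σ and hence (a + 1) · Σ = 0.
  ∑-elements≡0 : ∀ {a} → a ≢ 0# → a ≢ 1# → ∑ id elements ≡ 0#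
  ∑-elements≡0 {a} a≢0 a≢1 = nonzero-cancel (a≢1 ∘ sum≡0⇒≡) (begin
    (a + 1#) * Σ            ≡⟨ distribʳ Σ a 1# ⟩
    a * Σ + 1# * Σ          ≡⟨ cong₂ _+_ (sym (∑-scale a elements)) (*-identityˡ Σ) ⟩
    ∑ (a *_) elements + Σ   ≡⟨ cong (_+ Σ) (∑-injective (a *_) (*-cancelˡ-nonzero a≢0)) ⟩
    Σ + Σ                   ≡⟨ x+x≡0 Σ ⟩
    0#                      ∎)
    where Σ = ∑ id elements

module Slopes (F : FiniteField) (two≡0 : FiniteField._+_ F (FiniteField.1# F) (FiniteField.1# F) ≡ FiniteField.0# F)
              (K : List (Plane.Triple F)) (affine-arc : Plane.IsAffineArc F K) where

  open FiniteField F
  open IsCommutativeRing isCommutativeRing using (+-isCommutativeMonoid; +-comm)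
  open Plane F
  open FieldFacts F
  open Char2 F two≡0
  open ≡-Reasoning

  private
    normalized : All Normalized K
    normalized = proj₁ (proj₁ (proj₁ affine-arc))

    K-unique : Unique K
    K-unique = proj₂ (proj₁ (proj₁ affine-arc))

    no-three-collinear : ∀ P Q R → P ∈ K → Q ∈ K → R ∈ K → P ≢ Q → P ≢ R → Q ≢ R → ¬ Collinear P Q R
    no-three-collinear = proj₂ (proj₁ affine-arc)

    off-l∞ : All (λ P → X₀ P ≢ 0#) K
    off-l∞ = proj₂ affine-arc

  -- Points of K are normalized and off l∞, hence of the form (1, x, y).
  X₀≡1 : ∀ {P} → P ∈ K → X₀ P ≡ 1#
  X₀≡1 P∈K with All.lookup normalized P∈K | All.lookup off-l∞ P∈K
  ... | inj₁ a≡1 | _ = a≡1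
  ... | inj₂ (inj₁ (a≡0 , _)) | a≢0 = contradiction a≡0 a≢0
  ... | inj₂ (inj₂ (a≡0 , _)) | a≢0 = contradiction a≡0 a≢0

  Consecutive : Triple → Triple → Set
  Consecutive P Q = X₁ Q ≡ X₁ P + 1#

  consecutive? : ∀ P Q → Dec (Consecutive P Q)
  consecutive? P Q = X₁ Q ≟ (X₁ P + 1#)

  -- symmetric because c + 1 + 1 = c in characteristic 2
  consecutive-sym : ∀ {P Q} → Consecutive P Q → Consecutive Q P
  consecutive-sym {P} {Q} xQ≡xP+1 = sym (≡-trans (cong (_+ 1#) xQ≡xP+1) ([x+y]+y≡x (X₁ P) 1#))

  consecutive-irrefl : ∀ {P} → ¬ Consecutive P P
  consecutive-irrefl {P} xP≡xP+1 = 0≢1 (begin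
    0#               ≡⟨ sym (x+x≡0 x) ⟩
    x + x            ≡⟨ cong (x +_) xP≡xP+1 ⟩
    x + (x + 1#)     ≡⟨ x+[x+y]≡y x 1# ⟩
    1#               ∎)
    where x = X₁ P

  open Handshake consecutive? (λ {P Q} → consecutive-sym {P} {Q}) (λ {P} → consecutive-irrefl {P})

  vertical-≤2 : ∀ {c} (ys : List Triple) → Unique ys → (∀ {Y} → Y ∈ ys → Y ∈ K × X₁ Y ≡ c) → length ys ≤ 2
  vertical-≤2 [] _ _ = z≤n
  vertical-≤2 (_ ∷ []) _ _ = s≤s z≤n
  vertical-≤2 (_ ∷ _ ∷ []) _ _ = s≤s (s≤s z≤n)
  vertical-≤2 (P ∷ Q ∷ R ∷ _) ((P≢Q ∷ P≢R ∷ _) ∷ (Q≢R ∷ _) ∷ _) on-line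
    with P∈K , xP≡c ← on-line (here refl)
       | Q∈K , xQ≡c ← on-line (there (here refl))
       | R∈K , xR≡c ← on-line (there (there (here refl)))
    = contradiction (collinear (X₀≡1 P∈K) (X₀≡1 Q∈K) (X₀≡1 R∈K) xP≡c xQ≡c xR≡c)
                    (no-three-collinear P Q R P∈K Q∈K R∈K P≢Q P≢R Q≢R)
    where
    collinear : ∀ {c P Q R} → X₀ P ≡ 1# → X₀ Q ≡ 1# → X₀ R ≡ 1# →
                X₁ P ≡ c → X₁ Q ≡ c → X₁ R ≡ c → Collinear P Q R
    collinear {c} {_ , _ , p} {_ , _ , q} {_ , _ , r} refl refl refl refl refl refl = vertical-det c p q r

  degree≤2 : ∀ P → degree K P ≤ 2
  degree≤2 P = vertical-≤2 (neighbours K P) (Unique.filter⁺ (consecutive? P) K-unique)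
                            (∈-filter⁻ (consecutive? P))

  -- the slope y_P + y_Q of an edge (the X₁-difference being 1)
  slope : Triple × Triple → Carrier
  slope (P , Q) = X₂ P + X₂ Q

  slopes : List Carrier
  slopes = map slope (edges K)

  slopes-≤ : length slopes ≤ length K
  slopes-≤ = subst (_≤ length K) (sym (length-map slope (edges K))) (edges-≤ {K} (λ {P} _ → degree≤2 P))

  InS⇒slope : ∀ {m} → InS m K 1# → m ∈ slopes
  InS⇒slope {m} (P , Q , P∈K , Q∈K , _ , xP≢xQ , m-def , 1≡xP+xQ) =
    Sum.[ (λ PQ∈ → subst (_∈ slopes) slope≡m (∈-map⁺ slope PQ∈))
        , (λ QP∈ → subst (_∈ slopes) (≡-trans (+-comm (X₂ Q) (X₂ P)) slope≡m) (∈-map⁺ slope QP∈)) ]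
      (edge-∈ P∈K Q∈K (xP≢xQ ∘ cong X₁) (translate (sym 1≡xP+xQ)))
    where
    slope≡m : X₂ P + X₂ Q ≡ m
    slope≡m = ≡-trans (sym (/1 _)) (≡-trans (cong (_ /_) 1≡xP+xQ) m-def)

  -- With as many slopes as points, every point has two neighbours, so each
  -- y-coordinate occurs twice among the slopes and their sum vanishes.
  ∑-slopes≡0 : length K ≤ length slopes → ∑ id slopes ≡ 0#
  ∑-slopes≡0 many = begin
    ∑ id slopes                         ≡⟨ ∑-map id slope (edges K) ⟩
    ∑ slope (edges K)                   ≡⟨ handshake +-isCommutativeMonoid X₂ K ⟩
    ∑ (λ P → degree K P · X₂ P) K       ≡⟨ ∑-cong K (λ {P} P∈K → ≡-trans (cong (_· X₂ P) (two-neighbours P∈K)) (2·≡0 (X₂ P))) ⟩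
    ∑ (λ _ → 0#) K                      ≡⟨ ∑-ε K ⟩
    0#                                  ∎
    where
    two-neighbours : ∀ {P} → P ∈ K → degree K P ≡ 2
    two-neighbours = degree≡2 {K} (λ {P} _ → degree≤2 P)
                              (subst (length K ≤_) (length-map slope (edges K)) many)

room : ∀ {k q} → k < q ∸ 5 → 6 +ℕ k ≤ q
room {k} {q} k<q∸5 = subst (_≤ q) (cong suc (ℕ.+-comm k 5))
  (ℕ.m≤o∸n⇒m+n≤o (suc k) (ℕ.<⇒≤ (ℕ.m∸n≢0⇒n<m (ℕ.m<n⇒n≢0 k<q∸5))) k<q∸5)

module Choice (F : FiniteField) (two≡0 : FiniteField._+_ F (FiniteField.1# F) (FiniteField.1# F) ≡ FiniteField.0# F)
              (K : List (Plane.Triple F)) (affine-arc : Plane.IsAffineArc F K)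
              (6+k≤q : 6 +ℕ length K ≤ FiniteField.order F) where

  open FiniteField F
  open Plane F
  open FieldFacts F
  open Char2 F two≡0
  open Slopes F two≡0 K affine-arc
  open ≡-Reasoning

  excluded : List Carrier
  excluded = 0# ∷ 1# ∷ slopes

  fits : ∀ n → n ≤ 4 → n +ℕ length excluded ≤ order
  fits n n≤4 = ℕ.≤-trans (ℕ.+-mono-≤ n≤4 (s≤s (s≤s slopes-≤))) 6+k≤q

  -- The field is not covered by the excluded values and a coset m + 𝔽₄: such a
  -- cover would enumerate F with exactly k slopes, so that the elements of F
  -- would sum to 0 + (0 + (1 + 0)) = 1 instead of 0.
  no-cover : ∀ {m ω} → ω * ω + ω + 1# ≡ 0# → ¬ (∀ x → x ∈ coset m ω ++ excluded)
  no-cover {m} {ω} ω-root cover = 0≢1 (begin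
    0#                                              ≡⟨ sym (∑-elements≡0 ω≢0 ω≢1) ⟩
    ∑ id elements                                   ≡⟨ ∑-↭ id enumeration ⟩
    ∑ id (coset m ω ++ excluded)                    ≡⟨ ∑-++ id (coset m ω) excluded ⟩
    ∑ id (coset m ω) + (0# + (1# + ∑ id slopes))   ≡⟨ cong₂ (λ a b → a + (0# + (1# + b))) (∑-coset m ω) (∑-slopes≡0 k≤slopes) ⟩
    0# + (0# + (1# + 0#))                           ≡⟨ ≡-trans (+-identityˡ _) (≡-trans (+-identityˡ _) (+-identityʳ _)) ⟩
    1#                                              ∎)
    where
    open IsCommutativeRing isCommutativeRing using (+-identityˡ; +-identityʳ)
    ω≢0 : ω ≢ 0#
    ω≢0 = proj₁ (root-∉𝔽₂ ω-root)
    ω≢1 : ω ≢ 1#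
    ω≢1 = proj₂ (root-∉𝔽₂ ω-root)
    enumeration : elements ↭ coset m ω ++ excluded
    enumeration = cover⇒↭ cover (fits 4 ℕ.≤-refl)
    k≤slopes : length K ≤ length slopes
    k≤slopes = ℕ.+-cancelˡ-≤ 6 _ _ (ℕ.≤-trans 6+k≤q (ℕ.≤-reflexive (↭-length enumeration)))

  GoodPair : Carrier → Carrier → Set
  GoodPair m₁ m₂ = m₁ ≢ 0# × m₂ ≢ 0# × m₁ ≢ m₂ × cube (m₁ + m₂) ≢ 1# ×
                   m₁ ≢ 1# × m₂ ≢ 1# × ¬ (InS m₁ K 1# ⊎ InS m₂ K 1#)

  good-pair : ∀ {m₁ m₂} → m₁ ∉ excluded → m₂ ∉ excluded → m₁ ≢ m₂ → cube (m₁ + m₂) ≢ 1# → GoodPair m₁ m₂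
  good-pair m₁∉ m₂∉ m₁≢m₂ cube≢1 =
    m₁∉ ∘ here , m₂∉ ∘ here , m₁≢m₂ , cube≢1 , m₁∉ ∘ there ∘ here , m₂∉ ∘ there ∘ here ,
    Sum.[ m₁∉ ∘ there ∘ there ∘ InS⇒slope , m₂∉ ∘ there ∘ there ∘ InS⇒slope ]

  outside-coset : ∀ {ω} m₁ → m₁ ∉ excluded → ω * ω + ω + 1# ≡ 0# → ∃[ m₂ ] GoodPair m₁ m₂
  outside-coset {ω} m₁ m₁∉ ω-root with escape-or-cover (coset m₁ ω ++ excluded)
  ... | inj₂ cover = contradiction cover (no-cover ω-root)
  ... | inj₁ (m₂ , m₂∉) =
    m₂ , good-pair m₁∉ (m₂∉ ∘ ∈-++⁺ʳ (coset m₁ ω)) (λ m₁≡m₂ → m₂∉ (here (sym m₁≡m₂)))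
                   (m₂∉ ∘ ∈-++⁺ˡ ∘ cube-root-in-coset ω-root)

  -- Take g ∉ excluded ∪ {m₁, m₁ + 1}; either g works, or m₁ + g is a root of z² + z + 1.
  second-choice : ∀ m₁ → m₁ ∉ excluded → ∃[ m₂ ] GoodPair m₁ m₂
  second-choice m₁ m₁∉ with escape (m₁ ∷ m₁ + 1# ∷ excluded) (fits 3 (s≤s (s≤s (s≤s z≤n))))
  ... | g , g∉ with cube (m₁ + g) ≟ 1#
  ...   | no cube≢1 = g , good-pair m₁∉ (g∉ ∘ there ∘ there) (λ m₁≡g → g∉ (here (sym m₁≡g))) cube≢1
  ...   | yes cube≡1 =
    outside-coset m₁ m₁∉ (primitive-cube-root cube≡1 (λ ω≡1 → g∉ (there (here (translate ω≡1)))))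

  good-pair-exists : ∃[ m₁ ] ∃[ m₂ ] GoodPair m₁ m₂
  good-pair-exists with m₁ , m₁∉ ← escape excluded (fits 1 (s≤s z≤n)) = m₁ , second-choice m₁ m₁∉

-- Only the characteristic (from q = 2^h), the affine-arc part of affine
-- completeness and the bound on k are needed.
lemma2p17 : (F : FiniteField) → (h : ℕ) → 1 ≤ h →
  FiniteField.order F ≡ 2 ^ h →
  let open FiniteField F
      open Plane F
  in (K : List Triple) →
     IsAffinelyComplete K →
     OnSecant K (0# , 0# , 1#) →
     length K < order ∸ 5 →
     ∃[ m₁ ] ∃[ m₂ ] (m₁ ≢ 0# × m₂ ≢ 0# × m₁ ≢ m₂ ×
       (m₁ + m₂) * (m₁ + m₂) * (m₁ + m₂) ≢ 1# ×
       m₁ ≢ 1# × m₂ ≢ 1# ×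
       ¬ (InS m₁ K 1# ⊎ InS m₂ K 1#))
lemma2p17 F h _ q≡2^h K (affine-arc , _) _ k<q∸5 =
  Choice.good-pair-exists F (FieldFacts.char2 F h q≡2^h) K affine-arc (room k<q∸5)
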